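{- Let $n\ge1$, $t\in(0,1)$, and let $\mathcal{F}$ be a nonempty family of increasing subsets of $\Omega=\{0,1\}^n$, each of measure $\mu=t$. Let $\mathcal{A},\mathcal{B}$ be drawn uniformly and independently from $\mathcal{F}$. Then $$\mathbb{E}\,\mathrm{Cor}(\mathcal{A},\mathcal{B})\ge\tfrac12\,t\log_2(1/t)\,\mathbb{E}\,I_{\min}(\mathcal{A}).$$ In particular, when $t=1/2$, $\mathbb{E}\,\mathrm{Cor}(\mathcal{A},\mathcal{B})\ge\tfrac14\,\mathbb{E}\,I_{\min}(\mathcal{A})$.
   Context: Subsets of $[n]$ are identified with elements of $\Omega=\{0,1\}^n$; $\mu$ is the uniform probability measure. A subset of $\Omega$ is increasing if it is closed under taking supersets. $\mathrm{Cor}(\mathcal{A},\mathcal{B})=\mu(\mathcal{A}\cap\mathcal{B})-\mu(\mathcal{A})\mu(\mathcal{B})$. $I_k(\mathcal{A})=2\mu(\{x\in\mathcal{A}: x\oplus e_k\notin\mathcal{A}\})$, where $x\oplus e_k$ flips the $k$-th coordinate of $x$; $I_{\min}(\mathcal{A})=\min_k I_k(\mathcal{A})$. -}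

module Defs where

open import Data.Bool using (Bool; true; false; not; _∧_; if_then_else_) renaming (_≤_ to _≤ᵇ_)
open import Data.Nat using (ℕ; zero; suc; _+_; _*_; _^_; _⊓_)
open import Data.Integer as ℤ using (ℤ; +_)
open import Data.Fin using (Fin)
open import Data.List using (List; []; _∷_; map; _++_; foldr; length)
open import Data.Nat.ListAction using (sum)
open import Data.List.Relation.Unary.AllPairs using (AllPairs)
open import Data.Vec using (Vec; []; _∷_; updateAt; allFin)
import Data.Vec as Vec
open import Data.Vec.Relation.Binary.Pointwise.Inductive using (Pointwise)
open import Data.Product using (∃)
open import Relation.Binary.PropositionalEquality using (_≡_; _≢_)

Point : ℕ → Set
Point n = Vec Bool n

points : (n : ℕ) → List (Point n)
points zero    = [] ∷ []
points (suc n) = map (false ∷_) (points n) ++ map (true ∷_) (points n)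

Subset : ℕ → Set
Subset n = Point n → Bool

-- Number of points in a subset  (μ(A) = count A / 2^n).
count : {n : ℕ} → Subset n → ℕ
count {n} A = sum (map (λ x → if A x then 1 else 0) (points n))

_⊑_ : {n : ℕ} → Point n → Point n → Set
x ⊑ y = Pointwise _≤ᵇ_ x y

Increasing : {n : ℕ} → Subset n → Set
Increasing {n} A = (x y : Point n) → x ⊑ y → A x ≡ true → A y ≡ true

flipAt : {n : ℕ} → Fin n → Point n → Point n
flipAt k x = updateAt x k not

-- |{x ∈ A : x ⊕ e_k ∉ A}|, so that I_k(A) = 2 · boundary k A / 2^n.
boundary : {n : ℕ} → Fin n → Subset n → ℕ
boundary k A = count (λ x → A x ∧ not (A (flipAt k x)))

-- min_k boundary k A, so that I_min(A) = 2 · minBoundary A / 2^n  (n ≥ 1).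
minBoundary : {n : ℕ} → Subset n → ℕ
minBoundary {zero}  A = 0
minBoundary {suc n} A =
  Vec.foldr (λ _ → ℕ) (λ k r → boundary k A ⊓ r) (boundary Fin.zero A) (allFin (suc n))
  where import Data.Fin as Fin

_∩_ : {n : ℕ} → Subset n → Subset n → Subset n
(A ∩ B) x = A x ∧ B x

Distinct : {n : ℕ} → Subset n → Subset n → Set
Distinct {n} A B = ∃ λ (x : Point n) → A x ≢ B x

-- 4^n · Cor(A,B) for sets of size k:  2^n |A∩B| − k².
scaledCor : {n : ℕ} → ℕ → Subset n → Subset n → ℤ
scaledCor {n} k A B = (+ (2 ^ n * count (A ∩ B))) ℤ.- (+ (k * k))

-- S = m² 4^n · E Cor(A,B)  for a family F (list) of m sets of size k.
corSum : {n : ℕ} → ℕ → List (Subset n) → ℤ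
corSum k F = foldr ℤ._+_ (+ 0) (map (λ A → foldr ℤ._+_ (+ 0) (map (λ B → scaledCor k A B) F)) F)

-- T = k · m · Σ_{A∈F} minBoundary A;   (1/2) t E I_min = T / (m² 4^n).
rhsWeight : {n : ℕ} → ℕ → List (Subset n) → ℕ
rhsWeight k F = k * length F * sum (map minBoundary F)

-- Two classical inequalities on the cube are combined.  Write g(x) for the number of
-- members containing x and D_i for the total i-boundary of the family.
--  * Bessel: corSum = 2^n Σ g² − (Σ g)² ≥ Σ_i Δ_i(g)², where Δ_i(g) = Σ_{x_i=1} g − Σ_{x_i=0} g;
--    for increasing sets Δ_i(g) = D_i, and Σ_i D_i² ≥ M · Σ_{A ∈ F} |∂A|.
--  * Edge isoperimetry: 2^(n|A|) ≤ |A|^|A| · 2^|∂A|, i.e. |∂A| ≥ k log₂(2^n/k).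
module Submission where

open import Defs
open import Data.Bool using (Bool; true; false; not; _∧_; if_then_else_)
open import Data.Fin using (Fin; zero; suc)
open import Data.List using (List; []; _∷_; map; _++_; length)
open import Data.List.Relation.Unary.All as All using (All; []; _∷_)
open import Data.Vec using ([]; _∷_)
open import Function using (_∘_)
open import Relation.Binary.PropositionalEquality

-- Inequalities between powers, culminating in the merge inequality
-- 2^(a+b) a^a b^b ≤ (a+b)^(a+b) 2^|a−b| that drives the isoperimetric induction.
module Entropy where

  open import Data.Nat
  open import Data.Nat.Properties
  open import Data.Sum using (inj₁; inj₂)
  open import Data.Nat.Solver using (module +-*-Solver)
  open +-*-Solver using (solve; _:+_; _:*_; _:=_; con)

  pow-distrib : ∀ x y n → (x * y) ^ n ≡ x ^ n * y ^ n
  pow-distrib x y zero = refl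
  pow-distrib x y (suc n) rewrite pow-distrib x y n =
    solve 4 (λ x y a b → x :* y :* (a :* b) := x :* a :* (y :* b)) refl x y (x ^ n) (y ^ n)

  selfPow-pos : ∀ y → 0 < y ^ y
  selfPow-pos zero = s≤s z≤n
  selfPow-pos (suc y) = m^n>0 (suc y) (suc y)

  bernoulli : ∀ y r q → y + r ≡ suc q → suc q ^ y * r ≤ suc q * q ^ y
  bernoulli zero r q eq rewrite eq = ≤-reflexive (*-comm (suc q ^ 0) (suc q))
  bernoulli (suc y) r q eq = begin
      suc q * Q * r        ≡⟨ solve 3 (λ a b c → a :* b :* c := b :* (a :* c)) refl (suc q) Q r ⟩
      Q * (suc q * r)      ≤⟨ *-monoʳ-≤ Q shift ⟩
      Q * (q * suc r)      ≡⟨ solve 3 (λ a b c → a :* (b :* c) := b :* (a :* c)) refl Q q (suc r) ⟩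
      q * (Q * suc r)      ≤⟨ *-monoʳ-≤ q (bernoulli y (suc r) q (trans (+-suc y r) eq)) ⟩
      q * (suc q * q ^ y)  ≡⟨ solve 3 (λ a b c → a :* (b :* c) := b :* (a :* c)) refl q (suc q) (q ^ y) ⟩
      suc q * (q * q ^ y)  ∎
    where
      open ≤-Reasoning
      Q = suc q ^ y
      -- (q+1)·r ≤ q·(r+1), because r ≤ q.
      shift : suc q * r ≤ q * suc r
      shift = begin
        suc q * r  ≡⟨ solve 2 (λ q r → (con 1 :+ q) :* r := r :+ q :* r) refl q r ⟩
        r + q * r  ≤⟨ +-monoˡ-≤ (q * r) (≤-trans (m≤n+m r y) (≤-reflexive (suc-injective eq))) ⟩
        q + q * r  ≡⟨ *-suc q r ⟨
        q * suc r  ∎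

  -- With q = y(y+2) and r = y² + y + 1 we have (y+1)² = q+1 and y + r = q+1,
  -- so Bernoulli's bound and the polynomial inequality (q+1)² ≤ r(y+2)² suffice.
  selfPow-logConvex : ∀ y → suc y ^ suc y * suc y ^ suc y ≤ suc (suc y) ^ suc (suc y) * y ^ y
  selfPow-logConvex y = *-cancelʳ-≤ _ _ r (begin
      suc y ^ suc y * suc y ^ suc y * r  ≡⟨ cong (_* r) (pow-distrib (suc y) (suc y) (suc y)) ⟨
      (suc y * suc y) ^ suc y * r        ≡⟨ cong (λ z → z ^ suc y * r) square ⟨
      suc q ^ suc y * r                  ≡⟨ *-assoc (suc q) (suc q ^ y) r ⟩
      suc q * (suc q ^ y * r)            ≤⟨ *-monoʳ-≤ (suc q) (bernoulli y r q sumIsSucQ) ⟩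
      suc q * (suc q * q ^ y)            ≡⟨ *-assoc (suc q) (suc q) (q ^ y) ⟨
      suc q * suc q * q ^ y              ≤⟨ *-monoˡ-≤ (q ^ y) polynomial ⟩
      r * (s * s) * q ^ y                ≡⟨ cong (λ z → r * (s * s) * z) (pow-distrib y s y) ⟩
      r * (s * s) * (y ^ y * s ^ y)      ≡⟨ solve 4 (λ r s a b → r :* (s :* s) :* (a :* b) := s :* (s :* b) :* a :* r)
                                                  refl r s (y ^ y) (s ^ y) ⟩
      s ^ s * y ^ y * r                  ∎)
    where
      open ≤-Reasoning
      s = suc (suc y)
      q = y * s
      r = suc (y + y * y)
      square : suc q ≡ suc y * suc y
      square = solve 1 (λ y → con 1 :+ y :* (con 2 :+ y) := (con 1 :+ y) :* (con 1 :+ y)) refl y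
      sumIsSucQ : y + r ≡ suc q
      sumIsSucQ = solve 1 (λ y → y :+ (con 1 :+ (y :+ y :* y)) := con 1 :+ y :* (con 2 :+ y)) refl y
      -- (y+1)⁴ ≤ (y² + y + 1)(y+2)²; the difference is y³ + 3y² + 4y + 3.
      polynomial : suc q * suc q ≤ r * (s * s)
      polynomial = begin
        suc q * suc q                                         ≤⟨ m≤m+n _ (y * y * y + 3 * (y * y) + 4 * y + 3) ⟩
        suc q * suc q + (y * y * y + 3 * (y * y) + 4 * y + 3) ≡⟨ solve 1 (λ y →
            (con 1 :+ y :* (con 2 :+ y)) :* (con 1 :+ y :* (con 2 :+ y)) :+ (y :* y :* y :+ con 3 :* (y :* y) :+ con 4 :* y :+ con 3)
              := (con 1 :+ (y :+ y :* y)) :* ((con 2 :+ y) :* (con 2 :+ y))) refl y ⟩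
        r * (s * s)                                           ∎

  -- Consequently the ratio (y+1)^(y+1) / y^y is nondecreasing:
  -- for u ≤ w,  (u+1)^(u+1) · w^w ≤ (w+1)^(w+1) · u^u   (here w = j + u).
  selfPow-ratio-mono : ∀ j u → suc u ^ suc u * (j + u) ^ (j + u) ≤ suc (j + u) ^ suc (j + u) * u ^ u
  selfPow-ratio-mono zero u = ≤-refl
  selfPow-ratio-mono (suc j) u = *-cancelʳ-≤ _ _ (w ^ w) {{>-nonZero (selfPow-pos w)}} (begin
      U * W * w ^ w      ≡⟨ solve 3 (λ a b c → a :* b :* c := a :* c :* b) refl U W (w ^ w) ⟩
      U * w ^ w * W      ≤⟨ *-monoˡ-≤ W (selfPow-ratio-mono j u) ⟩
      W * u ^ u * W      ≡⟨ solve 3 (λ a b c → a :* b :* c := a :* c :* b) refl W (u ^ u) W ⟩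
      W * W * u ^ u      ≤⟨ *-monoˡ-≤ (u ^ u) (selfPow-logConvex w) ⟩
      W′ * w ^ w * u ^ u ≡⟨ solve 3 (λ a b c → a :* b :* c := a :* c :* b) refl W′ (w ^ w) (u ^ u) ⟩
      W′ * u ^ u * w ^ w ∎)
    where
      open ≤-Reasoning
      w = j + u
      U = suc u ^ suc u
      W = suc w ^ suc w
      W′ = suc (suc w) ^ suc (suc w)

  -- For b ≤ a:  4^b · a^a · b^b ≤ (a+b)^(a+b), with equality when a = b.
  -- Proved for a = j + b by induction on j, each step being an instance of the
  -- monotonicity of (y+1)^(y+1)/y^y.
  balanced-merge : ∀ {a b} → b ≤ a → 2 ^ (b + b) * (a ^ a * b ^ b) ≤ (a + b) ^ (a + b)
  balanced-merge {a} {b} b≤a =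
    subst (λ a → 2 ^ (b + b) * (a ^ a * b ^ b) ≤ (a + b) ^ (a + b)) (m∸n+n≡m b≤a) (offset (a ∸ b))
    where
      offset : ∀ j → 2 ^ (b + b) * ((j + b) ^ (j + b) * b ^ b) ≤ (j + b + b) ^ (j + b + b)
      offset zero = ≤-reflexive (begin-equality
          2 ^ (b + b) * (b ^ b * b ^ b)  ≡⟨ cong (2 ^ (b + b) *_) (^-distribˡ-+-* b b b) ⟨
          2 ^ (b + b) * b ^ (b + b)      ≡⟨ pow-distrib 2 b (b + b) ⟨
          (2 * b) ^ (b + b)              ≡⟨ cong (_^ (b + b)) (solve 1 (λ b → con 2 :* b := b :+ b) refl b) ⟩
          (b + b) ^ (b + b)              ∎)
        where open ≤-Reasoning
      offset (suc j) = *-cancelʳ-≤ _ _ (u ^ u) {{>-nonZero (selfPow-pos u)}} (begin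
          C * (U * b ^ b) * u ^ u  ≡⟨ solve 4 (λ c s x y → c :* (s :* x) :* y := c :* (y :* x) :* s) refl C U (b ^ b) (u ^ u) ⟩
          C * (u ^ u * b ^ b) * U  ≤⟨ *-monoˡ-≤ U (offset j) ⟩
          v ^ v * U                ≡⟨ *-comm (v ^ v) U ⟩
          U * v ^ v                ≤⟨ subst (λ z → U * z ^ z ≤ suc z ^ suc z * u ^ u) (+-comm b u) (selfPow-ratio-mono b u) ⟩
          suc v ^ suc v * u ^ u    ∎)
        where
          open ≤-Reasoning
          C = 2 ^ (b + b)
          u = j + b
          v = u + b
          U = suc u ^ suc u

  merge-ordered : ∀ {a b β} → b ≤ a → a ∸ b ≤ β →
    2 ^ (a + b) * (a ^ a * b ^ b) ≤ (a + b) ^ (a + b) * 2 ^ β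
  merge-ordered {a} {b} {β} b≤a a∸b≤β = begin
      2 ^ (a + b) * (a ^ a * b ^ b)                  ≡⟨ cong (λ e → 2 ^ e * (a ^ a * b ^ b)) split ⟩
      2 ^ ((a ∸ b) + (b + b)) * (a ^ a * b ^ b)      ≡⟨ cong (_* (a ^ a * b ^ b)) (^-distribˡ-+-* 2 (a ∸ b) (b + b)) ⟩
      2 ^ (a ∸ b) * 2 ^ (b + b) * (a ^ a * b ^ b)    ≡⟨ *-assoc (2 ^ (a ∸ b)) _ _ ⟩
      2 ^ (a ∸ b) * (2 ^ (b + b) * (a ^ a * b ^ b))  ≤⟨ *-mono-≤ (^-monoʳ-≤ 2 a∸b≤β) (balanced-merge b≤a) ⟩
      2 ^ β * (a + b) ^ (a + b)                      ≡⟨ *-comm (2 ^ β) _ ⟩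
      (a + b) ^ (a + b) * 2 ^ β                      ∎
    where
      open ≤-Reasoning
      split : a + b ≡ (a ∸ b) + (b + b)
      split = trans (cong (_+ b) (sym (m∸n+n≡m b≤a))) (+-assoc (a ∸ b) b b)

  merge : ∀ a b {β} → a ∸ b ≤ β → b ∸ a ≤ β →
    2 ^ (a + b) * (a ^ a * b ^ b) ≤ (a + b) ^ (a + b) * 2 ^ β
  merge a b {β} h₁ h₂ with ≤-total b a
  ... | inj₁ b≤a = merge-ordered b≤a h₁
  ... | inj₂ a≤b = subst₂ _≤_
    (cong₂ (λ e p → 2 ^ e * p) (+-comm b a) (*-comm (b ^ b) (a ^ a)))
    (cong (λ e → e ^ e * 2 ^ β) (+-comm b a))
    (merge-ordered a≤b h₂)

  -- Inductive step of the edge-isoperimetric inequality: if the two halves of a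
  -- set (sizes a, b) satisfy 2^(n·c) ≤ c^c · 2^E with boundary sizes E₀, E₁, and
  -- at least |a − b| = β edges cross between the halves, then the whole set
  -- satisfies the bound in dimension n+1 with boundary size β + E₀ + E₁.
  isoperimetric-step : ∀ n a b β E₀ E₁ → a ∸ b ≤ β → b ∸ a ≤ β →
    2 ^ (n * a) ≤ a ^ a * 2 ^ E₀ → 2 ^ (n * b) ≤ b ^ b * 2 ^ E₁ →
    2 ^ (suc n * (a + b)) ≤ (a + b) ^ (a + b) * 2 ^ (β + (E₀ + E₁))
  isoperimetric-step n a b β E₀ E₁ h₁ h₂ iso₀ iso₁ = begin
      2 ^ (suc n * (a + b))                              ≡⟨ cong (λ e → 2 ^ ((a + b) + e)) (*-distribˡ-+ n a b) ⟩
      2 ^ ((a + b) + (n * a + n * b))                    ≡⟨ ^-distribˡ-+-* 2 (a + b) _ ⟩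
      2 ^ (a + b) * 2 ^ (n * a + n * b)                  ≡⟨ cong (2 ^ (a + b) *_) (^-distribˡ-+-* 2 (n * a) (n * b)) ⟩
      2 ^ (a + b) * (2 ^ (n * a) * 2 ^ (n * b))          ≤⟨ *-monoʳ-≤ (2 ^ (a + b)) (*-mono-≤ iso₀ iso₁) ⟩
      2 ^ (a + b) * (a ^ a * 2 ^ E₀ * (b ^ b * 2 ^ E₁))  ≡⟨ solve 5 (λ t x y z w → t :* (x :* z :* (y :* w)) := t :* (x :* y) :* (z :* w))
                                                                refl (2 ^ (a + b)) (a ^ a) (b ^ b) (2 ^ E₀) (2 ^ E₁) ⟩
      2 ^ (a + b) * (a ^ a * b ^ b) * (2 ^ E₀ * 2 ^ E₁)  ≤⟨ *-monoˡ-≤ _ (merge a b h₁ h₂) ⟩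
      (a + b) ^ (a + b) * 2 ^ β * (2 ^ E₀ * 2 ^ E₁)      ≡⟨ cong (λ z → (a + b) ^ (a + b) * 2 ^ β * z) (^-distribˡ-+-* 2 E₀ E₁) ⟨
      (a + b) ^ (a + b) * 2 ^ β * 2 ^ (E₀ + E₁)          ≡⟨ *-assoc ((a + b) ^ (a + b)) _ _ ⟩
      (a + b) ^ (a + b) * (2 ^ β * 2 ^ (E₀ + E₁))        ≡⟨ cong ((a + b) ^ (a + b) *_) (^-distribˡ-+-* 2 β (E₀ + E₁)) ⟨
      (a + b) ^ (a + b) * 2 ^ (β + (E₀ + E₁))            ∎
    where open ≤-Reasoning

module Sums where

  open import Data.Nat
  open import Data.Nat.Properties
  open import Data.Nat.ListAction using (sum)
  open import Data.Nat.ListAction.Properties using (sum-++)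
  open import Data.List.Properties using (map-++; map-∘; map-cong)
  open import Algebra.Properties.CommutativeSemigroup +-commutativeSemigroup using (interchange)
  import Algebra.Properties.Semiring.Sum as SemiringSum

  listSum : {X : Set} → List X → (X → ℕ) → ℕ
  listSum xs f = sum (map f xs)

  infixl 10 listSum
  syntax listSum xs (λ x → e) = ∑[ x ∈ xs ] e

  private variable X Y : Set

  ∑-cong : ∀ (xs : List X) {f g : X → ℕ} → (∀ x → f x ≡ g x) → ∑[ x ∈ xs ] f x ≡ ∑[ x ∈ xs ] g x
  ∑-cong xs f≗g = cong sum (map-cong f≗g xs)

  ∑-cong-All : ∀ {xs : List X} {f g : X → ℕ} → All (λ x → f x ≡ g x) xs → ∑[ x ∈ xs ] f x ≡ ∑[ x ∈ xs ] g x
  ∑-cong-All []       = refl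
  ∑-cong-All (e ∷ es) = cong₂ _+_ e (∑-cong-All es)

  ∑-+ : ∀ (xs : List X) (f g : X → ℕ) → ∑[ x ∈ xs ] (f x + g x) ≡ ∑[ x ∈ xs ] f x + ∑[ x ∈ xs ] g x
  ∑-+ []       f g = refl
  ∑-+ (y ∷ xs) f g = trans (cong (f y + g y +_) (∑-+ xs f g)) (interchange (f y) (g y) _ _)

  ∑-*ˡ : ∀ (xs : List X) c (f : X → ℕ) → ∑[ x ∈ xs ] (c * f x) ≡ c * ∑[ x ∈ xs ] f x
  ∑-*ˡ []       c f = sym (*-zeroʳ c)
  ∑-*ˡ (y ∷ xs) c f = trans (cong (c * f y +_) (∑-*ˡ xs c f)) (sym (*-distribˡ-+ c (f y) _))

  ∑-*ʳ : ∀ (xs : List X) c (f : X → ℕ) → ∑[ x ∈ xs ] (f x * c) ≡ ∑[ x ∈ xs ] f x * c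
  ∑-*ʳ []       c f = refl
  ∑-*ʳ (y ∷ xs) c f = trans (cong (f y * c +_) (∑-*ʳ xs c f)) (sym (*-distribʳ-+ c (f y) _))

  ∑-const : ∀ (xs : List X) c → ∑[ x ∈ xs ] c ≡ length xs * c
  ∑-const []       c = refl
  ∑-const (y ∷ xs) c = cong (c +_) (∑-const xs c)

  ∑-mono : ∀ (xs : List X) {f g : X → ℕ} → (∀ x → f x ≤ g x) → ∑[ x ∈ xs ] f x ≤ ∑[ x ∈ xs ] g x
  ∑-mono []       f≤g = z≤n
  ∑-mono (y ∷ xs) f≤g = +-mono-≤ (f≤g y) (∑-mono xs f≤g)

  ∑-map : ∀ (φ : X → Y) (xs : List X) (f : Y → ℕ) → ∑[ y ∈ map φ xs ] f y ≡ ∑[ x ∈ xs ] f (φ x)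
  ∑-map φ xs f = cong sum (sym (map-∘ xs))

  ∑-swap : ∀ (xs : List X) (ys : List Y) (f : X → Y → ℕ) →
    ∑[ x ∈ xs ] ∑[ y ∈ ys ] f x y ≡ ∑[ y ∈ ys ] ∑[ x ∈ xs ] f x y
  ∑-swap []       ys f = sym (trans (∑-const ys 0) (*-zeroʳ (length ys)))
  ∑-swap (x ∷ xs) ys f =
    trans (cong (∑[ y ∈ ys ] f x y +_) (∑-swap xs ys f)) (sym (∑-+ ys (f x) (λ y → ∑[ x ∈ xs ] f x y)))

  ∑-cube : ∀ n (f : Point (suc n) → ℕ) →
    ∑[ x ∈ points (suc n) ] f x ≡ ∑[ y ∈ points n ] f (false ∷ y) + ∑[ y ∈ points n ] f (true ∷ y)
  ∑-cube n f = begin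
      sum (map f (map (false ∷_) P ++ map (true ∷_) P))             ≡⟨ cong sum (map-++ f (map (false ∷_) P) _) ⟩
      sum (map f (map (false ∷_) P) ++ map f (map (true ∷_) P))     ≡⟨ sum-++ (map f (map (false ∷_) P)) _ ⟩
      sum (map f (map (false ∷_) P)) + sum (map f (map (true ∷_) P)) ≡⟨ cong₂ _+_ (∑-map (false ∷_) P f) (∑-map (true ∷_) P f) ⟩
      ∑[ y ∈ P ] f (false ∷ y) + ∑[ y ∈ P ] f (true ∷ y)              ∎
    where
      open ≡-Reasoning
      P = points n

  module ℕΣ = SemiringSum +-*-semiring
  open ℕΣ public using (sum-syntax)

  ∑<-mono : ∀ n {f g : Fin n → ℕ} → (∀ i → f i ≤ g i) → ∑[ i < n ] f i ≤ ∑[ i < n ] g i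
  ∑<-mono zero    f≤g = z≤n
  ∑<-mono (suc n) f≤g = +-mono-≤ (f≤g zero) (∑<-mono n (f≤g ∘ suc))

  ∑-∑< : ∀ n (xs : List X) (f : X → Fin n → ℕ) → ∑[ x ∈ xs ] ∑[ i < n ] f x i ≡ ∑[ i < n ] ∑[ x ∈ xs ] f x i
  ∑-∑< n []       f = sym (ℕΣ.sum-replicate-zero n)
  ∑-∑< n (x ∷ xs) f = trans (cong (∑[ i < n ] f x i +_) (∑-∑< n xs f)) (sym (ℕΣ.∑-distrib-+ (f x) _))

-- The edge-isoperimetric inequality on the cube, by splitting along the first coordinate.
module Isoperimetry where

  open import Data.Nat
  open import Data.Nat.Properties
  open Entropy
  open Sums

  χ : ∀ {n} → Subset n → Point n → ℕ
  χ A x = if A x then 1 else 0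

  lower upper : ∀ {n} → Subset (suc n) → Subset n
  lower A y = A (false ∷ y)
  upper A y = A (true ∷ y)

  _∖_ : ∀ {n} → Subset n → Subset n → Subset n
  (A ∖ B) x = A x ∧ not (B x)

  count-halves : ∀ {n} (A : Subset (suc n)) → count A ≡ count (lower A) + count (upper A)
  count-halves {n} A = ∑-cube n (χ A)

  boundary-first : ∀ {n} (A : Subset (suc n)) →
    boundary zero A ≡ count (lower A ∖ upper A) + count (upper A ∖ lower A)
  boundary-first {n} A = ∑-cube n (χ (λ x → A x ∧ not (A (flipAt zero x))))

  boundary-later : ∀ {n} (i : Fin n) (A : Subset (suc n)) →
    boundary (suc i) A ≡ boundary i (lower A) + boundary i (upper A)
  boundary-later {n} i A = ∑-cube n (χ (λ x → A x ∧ not (A (flipAt (suc i) x))))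

  edgeBoundary : ∀ {n} → Subset n → ℕ
  edgeBoundary {n} A = ∑[ i < n ] boundary i A

  edgeBoundary-halves : ∀ {n} (A : Subset (suc n)) →
    edgeBoundary A ≡ boundary zero A + (edgeBoundary (lower A) + edgeBoundary (upper A))
  edgeBoundary-halves {n} A = cong (boundary zero A +_) (begin
      ∑[ i < n ] boundary (suc i) A                                  ≡⟨ ℕΣ.sum-cong-≗ (λ i → boundary-later i A) ⟩
      ∑[ i < n ] (boundary i (lower A) + boundary i (upper A))       ≡⟨ ℕΣ.∑-distrib-+ (λ i → boundary i (lower A)) _ ⟩
      edgeBoundary (lower A) + edgeBoundary (upper A)                ∎)
    where open ≡-Reasoning

  -- |X| − |Y| ≤ |X ∖ Y|, since χ X ≤ χ (X ∖ Y) + χ Y pointwise.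
  count-∸ : ∀ {n} (X Y : Subset n) → count X ∸ count Y ≤ count (X ∖ Y)
  count-∸ {n} X Y = m≤n+o⇒m∸n≤o (count X) (count Y) (begin
      count X                                  ≤⟨ ∑-mono (points n) (λ x → pointwise (X x) (Y x)) ⟩
      ∑[ x ∈ points n ] (χ (X ∖ Y) x + χ Y x)  ≡⟨ ∑-+ (points n) (χ (X ∖ Y)) (χ Y) ⟩
      count (X ∖ Y) + count Y                  ≡⟨ +-comm (count (X ∖ Y)) (count Y) ⟩
      count Y + count (X ∖ Y)                  ∎)
    where
      open ≤-Reasoning
      pointwise : ∀ p q → (if p then 1 else 0) ≤ (if p ∧ not q then 1 else 0) + (if q then 1 else 0)
      pointwise false q     = z≤n
      pointwise true  false = s≤s z≤n
      pointwise true  true  = s≤s z≤n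

  -- Induction on n: the
  -- halves satisfy it in dimension n, and at least ||A₀| − |A₁|| edges of the first
  -- direction leave A.
  edge-isoperimetric : ∀ n (A : Subset n) → 2 ^ (n * count A) ≤ count A ^ count A * 2 ^ edgeBoundary A
  edge-isoperimetric zero    A = ≤-trans (selfPow-pos (count A)) (≤-reflexive (sym (*-identityʳ _)))
  edge-isoperimetric (suc n) A
    rewrite count-halves A | edgeBoundary-halves A | boundary-first A =
    isoperimetric-step n (count (lower A)) (count (upper A)) _
      (edgeBoundary (lower A)) (edgeBoundary (upper A))
      (≤-trans (count-∸ (lower A) (upper A)) (m≤m+n _ _))
      (≤-trans (count-∸ (upper A) (lower A)) (m≤n+m _ _))
      (edge-isoperimetric n (lower A)) (edge-isoperimetric n (upper A))

module Variance where

  open import Data.Nat as ℕ using (ℕ; zero; suc; _^_)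
  open import Data.Integer hiding (suc; _^_)
  open import Data.Integer.Properties
  open import Data.Integer.Solver using (module +-*-Solver)
  open +-*-Solver using (solve; _:+_; _:*_; _:-_; _:=_; con)
  import Algebra.Properties.Semiring.Sum as SemiringSum

  module ℤΣ = SemiringSum +-*-semiring
  open ℤΣ public using (sum-syntax)

  ∑<-mono : ∀ n {f g : Fin n → ℤ} → (∀ i → f i ≤ g i) → ∑[ i < n ] f i ≤ ∑[ i < n ] g i
  ∑<-mono zero    f≤g = ≤-refl
  ∑<-mono (suc n) f≤g = +-mono-≤ (f≤g zero) (∑<-mono n (f≤g ∘ suc))

  ∑Ω : (n : ℕ) → (Point n → ℤ) → ℤ
  ∑Ω zero    g = g []
  ∑Ω (suc n) g = ∑Ω n (λ y → g (false ∷ y)) + ∑Ω n (λ y → g (true ∷ y))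

  -- Total discrete derivative in direction i:  Δ g i = Σ_{x_i = 1} g x − Σ_{x_i = 0} g x,
  -- i.e. 2^n times the level-one Fourier coefficient of g at {i}, up to sign.
  Δ : (n : ℕ) → (Point n → ℤ) → Fin n → ℤ
  Δ (suc n) g zero    = ∑Ω n (λ y → g (true ∷ y)) - ∑Ω n (λ y → g (false ∷ y))
  Δ (suc n) g (suc i) = Δ n (λ y → g (false ∷ y)) i + Δ n (λ y → g (true ∷ y)) i

  -- 4^n times the variance of g under the uniform measure:  2^n Σ g² − (Σ g)².
  variance : (n : ℕ) → (Point n → ℤ) → ℤ
  variance n g = + (2 ^ n) * ∑Ω n (λ x → g x * g x) - ∑Ω n g * ∑Ω n g

  square-nonneg : ∀ x → + 0 ≤ x * x
  square-nonneg (+ n)    = subst (+ 0 ≤_) (pos-* n n) (+≤+ ℕ.z≤n)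
  square-nonneg -[1+ n ] = +≤+ ℕ.z≤n

  -- (a + b)² ≤ 2a² + 2b², because the difference is (a − b)².
  square-of-sum : ∀ a b → (a + b) * (a + b) ≤ + 2 * (a * a) + + 2 * (b * b)
  square-of-sum a b = subst ((a + b) * (a + b) ≤_) parallelogram
    (i≤i+j-nonneg ((a + b) * (a + b)) (square-nonneg (a - b)))
    where
    parallelogram : (a + b) * (a + b) + (a - b) * (a - b) ≡ + 2 * (a * a) + + 2 * (b * b)
    parallelogram = solve 2 (λ a b → (a :+ b) :* (a :+ b) :+ (a :- b) :* (a :- b)
                                    := con (+ 2) :* (a :* a) :+ con (+ 2) :* (b :* b)) refl a b
    i≤i+j-nonneg : ∀ i {j} → + 0 ≤ j → i ≤ i + j
    i≤i+j-nonneg i 0≤j = subst (_≤ i + _) (+-identityʳ i) (+-monoʳ-≤ i 0≤j)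

  -- Induction on n: direction 0 contributes (S₁ − S₀)², and each later direction
  -- is bounded by twice the contributions of the two halves.
  bessel : ∀ n (g : Point n → ℤ) → ∑[ i < n ] (Δ n g i * Δ n g i) ≤ variance n g
  bessel zero    g = ≤-reflexive (solve 1 (λ x → con (+ 0) := con (+ 1) :* (x :* x) :- x :* x) refl (g []))
  bessel (suc n) g = begin
      D + ∑[ i < n ] ((a i + b i) * (a i + b i))                      ≤⟨ +-monoʳ-≤ D (∑<-mono n (λ i → square-of-sum (a i) (b i))) ⟩
      D + ∑[ i < n ] (+ 2 * (a i * a i) + + 2 * (b i * b i))          ≡⟨ cong (λ z → D + z) (linear (λ i → a i * a i) (λ i → b i * b i)) ⟩
      D + (+ 2 * ∑[ i < n ] (a i * a i) + + 2 * ∑[ i < n ] (b i * b i)) ≤⟨ +-monoʳ-≤ D (+-mono-≤ (*-monoˡ-≤-nonNeg (+ 2) (bessel n g₀))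
                                                                                                  (*-monoˡ-≤-nonNeg (+ 2) (bessel n g₁))) ⟩
      D + (+ 2 * variance n g₀ + + 2 * variance n g₁)                  ≡⟨ solve 5 (λ P Q₀ Q₁ S₀ S₁ →
          (S₁ :- S₀) :* (S₁ :- S₀) :+ (con (+ 2) :* (P :* Q₀ :- S₀ :* S₀) :+ con (+ 2) :* (P :* Q₁ :- S₁ :* S₁))
            := con (+ 2) :* P :* (Q₀ :+ Q₁) :- (S₀ :+ S₁) :* (S₀ :+ S₁)) refl (+ (2 ^ n)) Q₀ Q₁ S₀ S₁ ⟩
      + 2 * + (2 ^ n) * (Q₀ + Q₁) - (S₀ + S₁) * (S₀ + S₁)              ≡⟨ cong (λ z → z * (Q₀ + Q₁) - (S₀ + S₁) * (S₀ + S₁)) (pos-* 2 (2 ^ n)) ⟨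
      variance (suc n) g                                               ∎
    where
      open ≤-Reasoning
      g₀ g₁ : Point n → ℤ
      g₀ y = g (false ∷ y)
      g₁ y = g (true ∷ y)
      a = Δ n g₀
      b = Δ n g₁
      S₀ = ∑Ω n g₀
      S₁ = ∑Ω n g₁
      Q₀ = ∑Ω n (λ x → g₀ x * g₀ x)
      Q₁ = ∑Ω n (λ x → g₁ x * g₁ x)
      D = (S₁ - S₀) * (S₁ - S₀)
      linear : ∀ (f h : Fin n → ℤ) → ∑[ i < n ] (+ 2 * f i + + 2 * h i) ≡ + 2 * ∑[ i < n ] f i + + 2 * ∑[ i < n ] h i
      linear f h = trans (ℤΣ.∑-distrib-+ (λ i → + 2 * f i) _)
                         (sym (cong₂ _+_ (ℤΣ.*-distribˡ-sum (+ 2) f) (ℤΣ.*-distribˡ-sum (+ 2) h)))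

-- For increasing sets, the discrete derivatives of the multiplicity are total boundaries.
module Influence where

  open import Data.Nat as ℕ using (ℕ; zero; suc)
  open import Data.Integer using (ℤ; +_; _+_; _-_)
  open import Data.Integer.Properties using (pos-+)
  open import Data.Integer.Solver using (module +-*-Solver)
  open +-*-Solver using (solve; _:+_; _:-_; _:=_)
  open import Data.Bool using (f≤t; b≤b)
  open import Data.Product using (_×_; _,_; proj₁; proj₂)
  import Data.Nat.Properties as ℕP
  import Data.Vec.Relation.Binary.Pointwise.Inductive as Pointwise
  import Data.List.Relation.Unary.All.Properties as All
  open Sums using (listSum; ∑-cong; ∑-cong-All; ∑-+; ∑-map; ∑-swap; ∑-cube)
  open Isoperimetry using (χ; lower; upper; _∖_; boundary-first; boundary-later)
  open Variance using (∑Ω; Δ)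

  multiplicity : ∀ {n} → List (Subset n) → Point n → ℕ
  multiplicity F x = ∑[ A ∈ F ] χ A x

  ∑Ω-cong : ∀ n {f g : Point n → ℤ} → (∀ x → f x ≡ g x) → ∑Ω n f ≡ ∑Ω n g
  ∑Ω-cong zero    f≗g = f≗g []
  ∑Ω-cong (suc n) f≗g = cong₂ _+_ (∑Ω-cong n (f≗g ∘ (false ∷_))) (∑Ω-cong n (f≗g ∘ (true ∷_)))

  Δ-cong : ∀ n {f g : Point n → ℤ} → (∀ x → f x ≡ g x) → ∀ i → Δ n f i ≡ Δ n g i
  Δ-cong (suc n) f≗g zero    = cong₂ _-_ (∑Ω-cong n (f≗g ∘ (true ∷_))) (∑Ω-cong n (f≗g ∘ (false ∷_)))
  Δ-cong (suc n) f≗g (suc i) = cong₂ _+_ (Δ-cong n (f≗g ∘ (false ∷_)) i) (Δ-cong n (f≗g ∘ (true ∷_)) i)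

  ∑Ω-nat : ∀ n (f : Point n → ℕ) → ∑Ω n (λ x → + f x) ≡ + ∑[ x ∈ points n ] f x
  ∑Ω-nat zero    f = cong +_ (sym (ℕP.+-identityʳ (f [])))
  ∑Ω-nat (suc n) f = begin
      ∑Ω n (λ y → + f (false ∷ y)) + ∑Ω n (λ y → + f (true ∷ y))
        ≡⟨ cong₂ _+_ (∑Ω-nat n (f ∘ (false ∷_))) (∑Ω-nat n (f ∘ (true ∷_))) ⟩
      + ∑[ y ∈ points n ] f (false ∷ y) + + ∑[ y ∈ points n ] f (true ∷ y)
        ≡⟨ pos-+ (∑[ y ∈ points n ] f (false ∷ y)) _ ⟨
      + (∑[ y ∈ points n ] f (false ∷ y) ℕ.+ ∑[ y ∈ points n ] f (true ∷ y))
        ≡⟨ cong +_ (∑-cube n f) ⟨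
      + ∑[ x ∈ points (suc n) ] f x ∎
    where open ≡-Reasoning

  increasing-halves : ∀ {n} {A : Subset (suc n)} → Increasing A → Increasing (lower A) × Increasing (upper A)
  increasing-halves inc =
    (λ x y x⊑y → inc (false ∷ x) (false ∷ y) (b≤b Pointwise.∷ x⊑y)) ,
    (λ x y x⊑y → inc (true ∷ x) (true ∷ y) (b≤b Pointwise.∷ x⊑y))

  -- For increasing A the lower half lies inside the upper half, and the excess of the
  -- upper half is exactly the boundary in the first direction.
  upper-count : ∀ {n} (A : Subset (suc n)) → Increasing A → count (upper A) ≡ count (lower A) ℕ.+ boundary zero A
  upper-count {n} A inc = begin
      count (upper A)
        ≡⟨ ∑-cong (points n) (λ y → pointwise (lower A y) (upper A y) (inc (false ∷ y) (true ∷ y) (f≤t Pointwise.∷ Pointwise.refl b≤b))) ⟩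
      ∑[ y ∈ points n ] (χ (lower A) y ℕ.+ (χ (lower A ∖ upper A) y ℕ.+ χ (upper A ∖ lower A) y))
        ≡⟨ ∑-+ (points n) (χ (lower A)) _ ⟩
      count (lower A) ℕ.+ ∑[ y ∈ points n ] (χ (lower A ∖ upper A) y ℕ.+ χ (upper A ∖ lower A) y)
        ≡⟨ cong (count (lower A) ℕ.+_) (trans (∑-+ (points n) (χ (lower A ∖ upper A)) _) (sym (boundary-first A))) ⟩
      count (lower A) ℕ.+ boundary zero A ∎
    where
      open ≡-Reasoning
      pointwise : ∀ p q → (p ≡ true → q ≡ true) →
        (if q then 1 else 0) ≡ (if p then 1 else 0) ℕ.+ ((if p ∧ not q then 1 else 0) ℕ.+ (if q ∧ not p then 1 else 0))
      pointwise false false p⇒q = refl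
      pointwise false true  p⇒q = refl
      pointwise true  true  p⇒q = refl
      pointwise true  false p⇒q with () ← p⇒q refl

  multiplicity-half : ∀ {n} (F : List (Subset (suc n))) (b : Bool) →
    ∑Ω n (λ y → + multiplicity F (b ∷ y)) ≡ + ∑[ A ∈ F ] count (λ y → A (b ∷ y))
  multiplicity-half {n} F b =
    trans (∑Ω-nat n (λ y → multiplicity F (b ∷ y))) (cong +_ (∑-swap (points n) F (λ y A → χ A (b ∷ y))))

  multiplicity-restrict : ∀ {n} (F : List (Subset (suc n))) (b : Bool) (y : Point n) →
    multiplicity F (b ∷ y) ≡ multiplicity (map (λ A y → A (b ∷ y)) F) y
  multiplicity-restrict F b y = sym (∑-map (λ A y → A (b ∷ y)) F (λ B → χ B y))

  pos-+-cancelˡ : ∀ a b → + (a ℕ.+ b) - + a ≡ + b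
  pos-+-cancelˡ a b = trans (cong (_- + a) (pos-+ a b)) (solve 2 (λ a b → a :+ b :- a := b) refl (+ a) (+ b))

  Δ-multiplicity : ∀ n (F : List (Subset n)) → All Increasing F → ∀ i →
    Δ n (λ x → + multiplicity F x) i ≡ + ∑[ A ∈ F ] boundary i A
  Δ-multiplicity (suc n) F increasing zero = begin
      ∑Ω n (λ y → + multiplicity F (true ∷ y)) - ∑Ω n (λ y → + multiplicity F (false ∷ y))
        ≡⟨ cong₂ _-_ (multiplicity-half F true) (multiplicity-half F false) ⟩
      + ∑[ A ∈ F ] count (upper A) - + L
        ≡⟨ cong (λ z → + z - + L) (trans (∑-cong-All (All.map (λ {A} → upper-count A) increasing))
                                          (∑-+ F (λ A → count (lower A)) (boundary zero))) ⟩
      + (L ℕ.+ ∑[ A ∈ F ] boundary zero A) - + L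
        ≡⟨ pos-+-cancelˡ L _ ⟩
      + ∑[ A ∈ F ] boundary zero A ∎
    where
      open ≡-Reasoning
      L = ∑[ A ∈ F ] count (lower A)
  Δ-multiplicity (suc n) F increasing (suc j) = begin
      Δ n (λ y → + multiplicity F (false ∷ y)) j + Δ n (λ y → + multiplicity F (true ∷ y)) j
        ≡⟨ cong₂ _+_ (Δ-cong n (cong +_ ∘ multiplicity-restrict F false) j)
                     (Δ-cong n (cong +_ ∘ multiplicity-restrict F true) j) ⟩
      Δ n (λ y → + multiplicity (map lower F) y) j + Δ n (λ y → + multiplicity (map upper F) y) j
        ≡⟨ cong₂ _+_ (Δ-multiplicity n (map lower F) (All.map⁺ (All.map (proj₁ ∘ increasing-halves) increasing)) j)
                     (Δ-multiplicity n (map upper F) (All.map⁺ (All.map (proj₂ ∘ increasing-halves) increasing)) j) ⟩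
      + ∑[ B ∈ map lower F ] boundary j B + + ∑[ B ∈ map upper F ] boundary j B
        ≡⟨ cong₂ (λ u v → + u + + v) (∑-map lower F (boundary j)) (∑-map upper F (boundary j)) ⟩
      + ∑[ A ∈ F ] boundary j (lower A) + + ∑[ A ∈ F ] boundary j (upper A)
        ≡⟨ pos-+ (∑[ A ∈ F ] boundary j (lower A)) _ ⟨
      + (∑[ A ∈ F ] boundary j (lower A) ℕ.+ ∑[ A ∈ F ] boundary j (upper A))
        ≡⟨ cong +_ (trans (∑-cong F (boundary-later j)) (∑-+ F (boundary j ∘ lower) (boundary j ∘ upper))) ⟨
      + ∑[ A ∈ F ] boundary (suc j) A ∎
    where open ≡-Reasoning

-- The correlation sum is the variance of the multiplicity, hence dominates Σ_i D_i².
module Correlation where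

  open import Data.Nat
  open import Data.Nat.Properties
  open import Data.Integer as ℤ using (ℤ; +_)
  import Data.Integer.Properties as ℤP
  open import Data.List using (foldr)
  open import Data.List.Properties using (map-cong)
  open import Data.Integer.Solver using (module +-*-Solver)
  open +-*-Solver using (solve; _:+_; _:-_; _:=_)
  open Sums
  open Isoperimetry using (χ)
  open Variance using (∑Ω; Δ; variance; bessel)
  open Influence using (multiplicity; ∑Ω-cong; ∑Ω-nat; Δ-multiplicity)
  open import Data.Product using (∃; _×_; _,_)
  open import Algebra.Properties.CommutativeSemigroup *-commutativeSemigroup using (interchange)

  private variable X : Set

  ∑-differences : ∀ (xs : List X) (f : X → ℕ) c →
    foldr ℤ._+_ (+ 0) (map (λ x → + f x ℤ.- + c) xs) ≡ + ∑[ x ∈ xs ] f x ℤ.- + (length xs * c)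
  ∑-differences []       f c = refl
  ∑-differences (x ∷ xs) f c = begin
      (+ f x ℤ.- + c) ℤ.+ foldr ℤ._+_ (+ 0) (map (λ x → + f x ℤ.- + c) xs)
        ≡⟨ cong (λ z → (+ f x ℤ.- + c) ℤ.+ z) (∑-differences xs f c) ⟩
      (+ f x ℤ.- + c) ℤ.+ (+ S ℤ.- + C)
        ≡⟨ solve 4 (λ a b x y → (a :- b) :+ (x :- y) := (a :+ x) :- (b :+ y)) refl (+ f x) (+ c) (+ S) (+ C) ⟩
      (+ f x ℤ.+ + S) ℤ.- (+ c ℤ.+ + C)
        ≡⟨ cong₂ ℤ._-_ (ℤP.pos-+ (f x) S) (ℤP.pos-+ c C) ⟨
      + (f x + S) ℤ.- + (c + C) ∎
    where
      open ≡-Reasoning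
      S = ∑[ x ∈ xs ] f x
      C = length xs * c

  count-∩ : ∀ {n} (A B : Subset n) → count (A ∩ B) ≡ ∑[ x ∈ points n ] (χ A x * χ B x)
  count-∩ {n} A B = ∑-cong (points n) (λ x → indicator-∧ (A x) (B x))
    where
    indicator-∧ : ∀ p q → (if p ∧ q then 1 else 0) ≡ (if p then 1 else 0) * (if q then 1 else 0)
    indicator-∧ false q     = refl
    indicator-∧ true  false = refl
    indicator-∧ true  true  = refl

  ∑-multiplicity : ∀ {n} (F : List (Subset n)) → ∑[ x ∈ points n ] multiplicity F x ≡ ∑[ A ∈ F ] count A
  ∑-multiplicity {n} F = ∑-swap (points n) F (λ x A → χ A x)

  ∑∑-count-∩ : ∀ {n} (F : List (Subset n)) →
    ∑[ A ∈ F ] ∑[ B ∈ F ] count (A ∩ B) ≡ ∑[ x ∈ points n ] (multiplicity F x * multiplicity F x)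
  ∑∑-count-∩ {n} F = begin
      ∑[ A ∈ F ] ∑[ B ∈ F ] count (A ∩ B)                     ≡⟨ ∑-cong F (λ A → ∑-cong F (count-∩ A)) ⟩
      ∑[ A ∈ F ] ∑[ B ∈ F ] ∑[ x ∈ P ] (χ A x * χ B x)         ≡⟨ ∑-cong F (λ A → ∑-swap F P (λ B x → χ A x * χ B x)) ⟩
      ∑[ A ∈ F ] ∑[ x ∈ P ] ∑[ B ∈ F ] (χ A x * χ B x)         ≡⟨ ∑-cong F (λ A → ∑-cong P (λ x → ∑-*ˡ F (χ A x) (λ B → χ B x))) ⟩
      ∑[ A ∈ F ] ∑[ x ∈ P ] (χ A x * multiplicity F x)         ≡⟨ ∑-swap F P (λ A x → χ A x * multiplicity F x) ⟩
      ∑[ x ∈ P ] ∑[ A ∈ F ] (χ A x * multiplicity F x)         ≡⟨ ∑-cong P (λ x → ∑-*ʳ F (multiplicity F x) (λ A → χ A x)) ⟩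
      ∑[ x ∈ P ] (multiplicity F x * multiplicity F x)         ∎
    where
      open ≡-Reasoning
      P = points n

  corSum-variance : ∀ {n} k (F : List (Subset n)) → All (λ A → count A ≡ k) F →
    corSum k F ≡ variance n (λ x → + multiplicity F x)
  corSum-variance {n} k F sizes = begin
      corSum k F
        ≡⟨ cong (foldr ℤ._+_ (+ 0)) (map-cong (λ A → ∑-differences F (λ B → 2 ^ n * count (A ∩ B)) (k * k)) F) ⟩
      foldr ℤ._+_ (+ 0) (map (λ A → + ∑[ B ∈ F ] (2 ^ n * count (A ∩ B)) ℤ.- + (m * (k * k))) F)
        ≡⟨ ∑-differences F (λ A → ∑[ B ∈ F ] (2 ^ n * count (A ∩ B))) (m * (k * k)) ⟩
      + ∑[ A ∈ F ] ∑[ B ∈ F ] (2 ^ n * count (A ∩ B)) ℤ.- + (m * (m * (k * k)))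
        ≡⟨ cong₂ (λ a b → + a ℤ.- + b) squares total ⟩
      + (2 ^ n * Q) ℤ.- + (T * T)
        ≡⟨ cong₂ ℤ._-_ (ℤP.pos-* (2 ^ n) Q) (ℤP.pos-* T T) ⟩
      + (2 ^ n) ℤ.* + Q ℤ.- + T ℤ.* + T
        ≡⟨ cong₂ (λ q t → + (2 ^ n) ℤ.* q ℤ.- t ℤ.* t)
             (trans (∑Ω-cong n (λ x → sym (ℤP.pos-* (g x) (g x)))) (∑Ω-nat n (λ x → g x * g x))) (∑Ω-nat n g) ⟨
      variance n (λ x → + g x) ∎
    where
      open ≡-Reasoning
      m = length F
      g = multiplicity F
      Q = ∑[ x ∈ points n ] (g x * g x)
      T = ∑[ x ∈ points n ] g x
      squares : ∑[ A ∈ F ] ∑[ B ∈ F ] (2 ^ n * count (A ∩ B)) ≡ 2 ^ n * Q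
      squares = trans (∑-cong F (λ A → ∑-*ˡ F (2 ^ n) (λ B → count (A ∩ B))))
                      (trans (∑-*ˡ F (2 ^ n) _) (cong (2 ^ n *_) (∑∑-count-∩ F)))
      T≡mk : T ≡ m * k
      T≡mk = trans (∑-multiplicity F) (trans (∑-cong-All sizes) (∑-const F k))
      total : m * (m * (k * k)) ≡ T * T
      total = trans (sym (*-assoc m m (k * k))) (trans (interchange m m k k) (cong (λ t → t * t) (sym T≡mk)))

  totalBoundary : ∀ {n} → List (Subset n) → Fin n → ℕ
  totalBoundary F i = ∑[ A ∈ F ] boundary i A

  ∑<-nat : ∀ n (f : Fin n → ℕ) → Variance.ℤΣ.sum (λ i → + f i) ≡ + ∑[ i < n ] f i
  ∑<-nat zero    f = refl
  ∑<-nat (suc n) f = trans (cong (λ z → + f zero ℤ.+ z) (∑<-nat n (f ∘ suc))) (sym (ℤP.pos-+ (f zero) _))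

  nonneg-witness : ∀ {S c} → + S ℤ.≤ c → ∃ λ s → c ≡ + s × S ≤ s
  nonneg-witness (ℤ.+≤+ S≤s) = _ , refl , S≤s

  -- Level-one bound: for a family of increasing k-sets the scaled correlation sum is
  -- a natural number s dominating Σ_i D_i²  (Bessel applied to the multiplicity function).
  level-one-bound : ∀ {n} k (F : List (Subset n)) → All Increasing F → All (λ A → count A ≡ k) F →
    ∃ λ s → corSum k F ≡ + s × ∑[ i < n ] (totalBoundary F i * totalBoundary F i) ≤ s
  level-one-bound {n} k F increasing sizes = nonneg-witness (begin
      + ∑[ i < n ] (totalBoundary F i * totalBoundary F i)
        ≡⟨ ∑<-nat n _ ⟨
      Variance.ℤΣ.sum (λ i → + (totalBoundary F i * totalBoundary F i))
        ≡⟨ Variance.ℤΣ.sum-cong-≗ (λ i → trans (ℤP.pos-* (totalBoundary F i) (totalBoundary F i)) (sym (cong₂ ℤ._*_ (Δ-total i) (Δ-total i)))) ⟩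
      Variance.ℤΣ.sum (λ i → Δ n g i ℤ.* Δ n g i)
        ≤⟨ bessel n g ⟩
      variance n g
        ≡⟨ corSum-variance k F sizes ⟨
      corSum k F ∎)
    where
      open ℤP.≤-Reasoning
      g : Point n → ℤ
      g x = + multiplicity F x
      Δ-total : ∀ i → Δ n g i ≡ + totalBoundary F i
      Δ-total = Δ-multiplicity n F increasing

module Assembly where

  open import Data.Nat
  open import Data.Nat.Properties
  open import Data.Vec as Vec using (Vec; lookup; allFin)
  open import Data.Vec.Properties using (lookup-allFin)
  open Sums
  open Entropy using (pow-distrib)
  open Isoperimetry using (edgeBoundary; edge-isoperimetric)
  open Correlation using (totalBoundary)
  open import Algebra.Properties.CommutativeSemigroup *-commutativeSemigroup using (interchange)

  minBoundary≤boundary : ∀ {n} (A : Subset n) (i : Fin n) → minBoundary A ≤ boundary i A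
  minBoundary≤boundary {suc n} A i =
    subst (λ j → minBoundary A ≤ boundary j A) (lookup-allFin i) (fold-min (allFin (suc n)) i)
    where
    fold-min : ∀ {m} (v : Vec (Fin (suc n)) m) (j : Fin m) →
      Vec.foldr (λ _ → ℕ) (λ k r → boundary k A ⊓ r) (boundary zero A) v ≤ boundary (lookup v j) A
    fold-min (k Vec.∷ v) zero    = m⊓n≤m (boundary k A) _
    fold-min (k Vec.∷ v) (suc j) = ≤-trans (m⊓n≤n (boundary k A) _) (fold-min v j)

  -- (Σ_A minB(A)) · (Σ_A |∂A|) = Σ_i (Σ_A minB(A)) · D_i ≤ Σ_i D_i².
  min-times-edge : ∀ {n} (F : List (Subset n)) →
    ∑[ A ∈ F ] minBoundary A * ∑[ A ∈ F ] edgeBoundary A ≤ ∑[ i < n ] (totalBoundary F i * totalBoundary F i)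
  min-times-edge {n} F = begin
      M * ∑[ A ∈ F ] edgeBoundary A       ≡⟨ cong (M *_) (∑-∑< n F (λ A i → boundary i A)) ⟩
      M * ∑[ i < n ] D i                  ≡⟨ ℕΣ.*-distribˡ-sum M D ⟩
      ∑[ i < n ] (M * D i)                ≤⟨ ∑<-mono n (λ i → *-monoˡ-≤ (D i) (∑-mono F (λ A → minBoundary≤boundary A i))) ⟩
      ∑[ i < n ] (D i * D i)              ∎
    where
      open ≤-Reasoning
      M = ∑[ A ∈ F ] minBoundary A
      D = totalBoundary F

  family-isoperimetric : ∀ n k (F : List (Subset n)) → All (λ A → count A ≡ k) F →
    (2 ^ (n * k)) ^ length F ≤ (k ^ k) ^ length F * 2 ^ ∑[ A ∈ F ] edgeBoundary A
  family-isoperimetric n k []      []           = ≤-refl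
  family-isoperimetric n k (A ∷ F) (refl ∷ sizes) = begin
      2 ^ (n * k) * (2 ^ (n * k)) ^ length F
        ≤⟨ *-mono-≤ (edge-isoperimetric n A) (family-isoperimetric n k F sizes) ⟩
      (k ^ k * 2 ^ E) * ((k ^ k) ^ length F * 2 ^ R)
        ≡⟨ interchange (k ^ k) (2 ^ E) _ _ ⟩
      (k ^ k * (k ^ k) ^ length F) * (2 ^ E * 2 ^ R)
        ≡⟨ cong ((k ^ k * (k ^ k) ^ length F) *_) (^-distribˡ-+-* 2 E R) ⟨
      (k ^ k) ^ length (A ∷ F) * 2 ^ (E + R) ∎
    where
      open ≤-Reasoning
      E = edgeBoundary A
      R = ∑[ B ∈ F ] edgeBoundary B

  exponent-bound : ∀ n k m M E s → (2 ^ (n * k)) ^ m ≤ (k ^ k) ^ m * 2 ^ E → M * E ≤ s →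
    2 ^ (n * (k * m * M)) ≤ k ^ (k * m * M) * 2 ^ s
  exponent-bound n k m M E s family M*E≤s = begin
      2 ^ (n * (k * m * M))                ≡⟨ cong (2 ^_) regroup ⟩
      2 ^ (n * k * m * M)                  ≡⟨ trans (cong (_^ M) (^-*-assoc 2 (n * k) m)) (^-*-assoc 2 (n * k * m) M) ⟨
      ((2 ^ (n * k)) ^ m) ^ M              ≤⟨ ^-monoˡ-≤ M family ⟩
      ((k ^ k) ^ m * 2 ^ E) ^ M            ≡⟨ pow-distrib ((k ^ k) ^ m) (2 ^ E) M ⟩
      ((k ^ k) ^ m) ^ M * (2 ^ E) ^ M      ≡⟨ cong₂ _*_ (trans (cong (_^ M) (^-*-assoc k k m)) (^-*-assoc k (k * m) M))
                                                       (^-*-assoc 2 E M) ⟩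
      k ^ (k * m * M) * 2 ^ (E * M)        ≤⟨ *-monoʳ-≤ (k ^ (k * m * M)) (^-monoʳ-≤ 2 (≤-trans (≤-reflexive (*-comm E M)) M*E≤s)) ⟩
      k ^ (k * m * M) * 2 ^ s              ∎
    where
      open ≤-Reasoning
      regroup : n * (k * m * M) ≡ n * k * m * M
      regroup = trans (sym (*-assoc n (k * m) M)) (cong (_* M) (sym (*-assoc n k m)))

  2^-reflect-≤ : ∀ {a b} → 2 ^ a ≤ 2 ^ b → a ≤ b
  2^-reflect-≤ 2^a≤2^b = ≮⇒≥ (λ b<a → <⇒≱ (^-monoʳ-< 2 (s≤s (s≤s z≤n)) b<a) 2^a≤2^b)

  -- When k = 2^(n−1) (i.e. t = 1/2), the bound 2^(nT) ≤ k^T · 2^s reads 2^T ≤ 2^s, so T ≤ s.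
  half-case : ∀ n → 1 ≤ n → ∀ k T s → 2 * k ≡ 2 ^ n → 2 ^ (n * T) ≤ k ^ T * 2 ^ s → T ≤ s
  half-case (suc n) _ k T s 2k≡2^[1+n] bound =
    2^-reflect-≤ (*-cancelʳ-≤ (2 ^ T) (2 ^ s) P {{m^n≢0 2 (n * T)}} (begin
      2 ^ T * P            ≡⟨ ^-distribˡ-+-* 2 T (n * T) ⟨
      2 ^ (suc n * T)      ≤⟨ bound ⟩
      k ^ T * 2 ^ s        ≡⟨ cong (λ z → z ^ T * 2 ^ s) k≡2^n ⟩
      (2 ^ n) ^ T * 2 ^ s  ≡⟨ cong (_* 2 ^ s) (^-*-assoc 2 n T) ⟩
      P * 2 ^ s            ≡⟨ *-comm P (2 ^ s) ⟩
      2 ^ s * P            ∎))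
    where
      open ≤-Reasoning
      P = 2 ^ (n * T)
      k≡2^n : k ≡ 2 ^ n
      k≡2^n = *-cancelˡ-≡ k (2 ^ n) 2 2k≡2^[1+n]

open import Data.Nat using (ℕ; _*_; _^_; _≤_; _<_)
open import Data.Nat.Properties using (≤-trans)
open import Data.Integer using (+_)
open import Data.List.Relation.Unary.AllPairs using (AllPairs)
open import Data.Product using (∃; _×_; _,_; proj₁; proj₂)
open Sums using (listSum; sum-syntax)
open Isoperimetry using (edgeBoundary)
open Correlation using (totalBoundary; level-one-bound)
open Assembly using (min-times-edge; family-isoperimetric; exponent-bound; half-case)

proposition8p2 : (n : ℕ) → 1 ≤ n → (k : ℕ) → 0 < k → k < 2 ^ n →
    (F : List (Subset n)) → F ≢ [] → AllPairs Distinct F →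
    All (λ A → Increasing A × count A ≡ k) F →
    ∃ λ (s : ℕ) → (corSum k F ≡ + s) ×
    (2 ^ (n * rhsWeight k F) ≤ k ^ rhsWeight k F * 2 ^ s) ×
    (2 * k ≡ 2 ^ n → rhsWeight k F ≤ s)
proposition8p2 n 1≤n k _ _ F _ _ members =
  s , corSum≡s , bound , λ 2k≡2^n → half-case n 1≤n k (rhsWeight k F) s 2k≡2^n bound
  where
    increasing : All Increasing F
    increasing = All.map proj₁ members
    sizes : All (λ A → count A ≡ k) F
    sizes = All.map proj₂ members
    level : ∃ λ s → corSum k F ≡ + s × ∑[ i < n ] (totalBoundary F i * totalBoundary F i) ≤ s
    level = level-one-bound k F increasing sizes
    s : ℕ
    s = proj₁ level
    corSum≡s : corSum k F ≡ + s
    corSum≡s = proj₁ (proj₂ level)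
    bound : 2 ^ (n * rhsWeight k F) ≤ k ^ rhsWeight k F * 2 ^ s
    bound = exponent-bound n k (length F) (∑[ A ∈ F ] minBoundary A) (∑[ A ∈ F ] edgeBoundary A) s
              (family-isoperimetric n k F sizes)
              (≤-trans (min-times-edge F) (proj₂ (proj₂ level)))
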